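{- Let $\mathcal R^{\mathsf{fip}}=\mathcal R(\mathsf{fip},\gamma^{\max})$, $r\in\mathcal R^{\mathsf{fip}}$, and $\varphi$ a formula. If $(\mathcal R^{\mathsf{fip}},r,t)\vDash K_i\varphi$ and $(i,t)\dashrightarrow(j,t')$, then $(\mathcal R^{\mathsf{fip}},r,t)\vDash K_i\big(@_{t'}K_j(@_t K_i\varphi)\big)$.
   Context: Model: a finite set of processes communicates over a directed network; each channel $i\to j$ has a known integer upper bound $b_{ij}\ge1$. Time is global and discrete, and every local state contains the current time. In $\gamma^{\max}$, a message sent on $i\to j$ at time $s$ is received at a nondeterministically chosen time in $[s+1,s+b_{ij}]$; processes may receive nondeterministic external inputs. $\mathcal R(P,\gamma^{\max})$ is the set of all runs of protocol $P$. A node $(i,t)$ is process $i$ at time $t$; $r_i(t)$ is $i$'s local state. Full-information protocol $\mathsf{fip}$: every process sends its local state on each of its outgoing channels at every time step, and retains a history of every local event and every message received, with their times. Knowledge: $(\mathcal R,r,t)\vDash K_i\varphi$ iff $(\mathcal R,r',t)\vDash\varphi$ for all $r'\in\mathcal R$ with $r'_i(t)=r_i(t)$. Timestamp: $(\mathcal R,r,s)\vDash @_t\varphi$ iff $(\mathcal R,r,t)\vDash\varphi$. $D(i,j)$: shortest-path distance in the network weighted by the $b_{ij}$ ($D(i,i)=0$). Bound guarantee: $(i,t)\dashrightarrow(j,t')$ iff $t+D(i,j)\le t'$. -}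

module Defs where

open import Data.Nat using (ℕ; zero; suc; _+_; _≤_; _≤ᵇ_)
open import Data.Fin using (Fin)
open import Data.List using (List; []; _∷_; _++_; [_]; map; concatMap; upTo; allFin)
open import Data.Product using (_×_; _,_; Σ; ∃; ∃-syntax)
open import Data.Bool using (if_then_else_; _∧_)
open import Relation.Nullary using (Dec; does)
open import Relation.Binary.PropositionalEquality using (_≡_)

record Network : Set₁ where
  field
    n      : ℕ
    Chan   : Fin n → Fin n → Set
    chan?  : (i j : Fin n) → Dec (Chan i j)
    b      : Fin n → Fin n → ℕ
    b≥1    : ∀ i j → Chan i j → 1 ≤ b i j

module Model (N : Network) (Input : Set) where
  open Network N

  data Walk : Fin n → Fin n → ℕ → Set where
    here : ∀ {i} → Walk i i 0
    step : ∀ {i k j w} → Chan i k → Walk k j w → Walk i j (b i k + w)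

  -- D(i,j) = d : d is the shortest-path distance (D(i,j) = ∞, i.e. no d,
  -- when there is no path).
  IsDist : Fin n → Fin n → ℕ → Set
  IsDist i j d = Walk i j d × (∀ {w} → Walk i j w → d ≤ w)

  -- Runs of γ^max: nondeterministic external inputs and, for every channel
  -- i→j and every sending time s, a delivery delay in [1, b i j]
  -- (the message sent at s is received at s + delay i j s).
  record Run : Set where
    field
      ext      : Fin n → ℕ → Input
      delay    : Fin n → Fin n → ℕ → ℕ
      delay≥1  : ∀ i j s → Chan i j → 1 ≤ delay i j s
      delay≤b  : ∀ i j s → Chan i j → delay i j s ≤ b i j
  open Run

  -- Local states under fip: current time, all external inputs with their
  -- times, all received messages (sender, receipt time, content = sender's
  -- local state at the sending time).
  data LState : Set where
    st : ℕ → List (ℕ × Input) → List (Fin n × ℕ × LState) → LState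

  stateAt : Run → ℕ → List (ℕ × (Fin n → LState)) → Fin n → LState
  stateAt r t past j =
    st t (map (λ u → u , ext r j u) (upTo (suc t)))
         (concatMap (λ { (s , σ) → concatMap (λ k →
              if does (chan? k j) ∧ (s + delay r k j s ≤ᵇ t)
              then [ (k , s + delay r k j s , σ k) ] else []) (allFin n) }) past)

  statesBefore : Run → ℕ → List (ℕ × (Fin n → LState))
  statesBefore r zero = []
  statesBefore r (suc t) = statesBefore r t ++ [ (t , stateAt r t (statesBefore r t)) ]

  -- r_i(t) in the fip protocol (fip sends its full state on every channel
  -- at every time step)
  local : Run → Fin n → ℕ → LState
  local r i t = stateAt r t (statesBefore r t) i

  Fact : Set₁
  Fact = Run → ℕ → Set

  K : Fin n → Fact → Fact
  K i φ r t = ∀ (r' : Run) → local r' i t ≡ local r i t → φ r' t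

  At : ℕ → Fact → Fact
  At t φ r s = φ r t

  _⇢_ : Fin n × ℕ → Fin n × ℕ → Set
  (i , t) ⇢ (j , t') = ∃[ d ] (IsDist i j d × t + d ≤ t')

module Submission where

-- The theorem reduces to one indistinguishability fact: if (i,t) ⇢ (j,t'),
-- then any two runs in which j has the same local state at time t' also give
-- i the same local state at time t.  Given that, in any run r' that i cannot
-- tell from r at t, and any r'' that j cannot tell from r' at t', i cannot
-- tell r'' from r at t, so K_i φ at (r,t) yields K_i φ at (r'',t).
--
-- The indistinguishability fact is proved by induction on a weighted walk
-- from i to j, from two properties of fip local states:
--   * persistence: i's state at t is a function of its state at any t' ≥ t
--     (restrict the input record and the received messages to time t);
--   * relay: if i → k is a channel and s + b(i,k) ≤ t, then k's state at t
--     contains the message i sent at s, whose content is i's state at s.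

open import Defs
open import Data.Nat
  using (ℕ; zero; suc; s≤s; _+_; _≤_; _<_; _≤ᵇ_; _≤′_; ≤′-refl; ≤′-step)
open import Data.Nat.Properties
  using (_≤?_; ≤-refl; ≤-trans; <-≤-trans; <⇒≱; m<m+n; +-monoʳ-≤; +-assoc; +-identityʳ;
         ≤⇒≤′; ≤′⇒≤)
open import Level using (Level)
open import Data.Fin using (Fin)
open import Data.Empty using (⊥-elim)
open import Data.Product using (_,_; _×_; ∃-syntax; proj₁; proj₂)
open import Data.Bool using (true; false; if_then_else_; _∧_)
open import Data.List
  using (List; []; _∷_; _++_; [_]; map; concatMap; upTo; applyUpTo; allFin; take; filter; _∷ʳ_)
open import Data.List.Properties
  using (take-map; map-++; upTo-∷ʳ; filter-++; filter-accept; filter-reject;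
         concatMap-cong; concatMap-++; ++-identityʳ)
open import Data.List.Relation.Unary.Any using (here)
open import Data.List.Membership.Propositional using (_∈_; find; lose)
open import Data.List.Membership.Propositional.Properties
  using (∈-map⁺; ∈-map⁻; ∈-upTo⁺; ∈-allFin; ∈-concatMap⁺; ∈-concatMap⁻)
open import Relation.Nullary using (does; yes; no; ¬_)
open import Relation.Nullary.Decidable using (dec-true; dec-false)
open import Relation.Unary using (Pred; Decidable)
open import Relation.Binary.PropositionalEquality
  using (_≡_; refl; sym; trans; cong; cong₂; subst; module ≡-Reasoning)

take-applyUpTo : {A : Set} (f : ℕ → A) {m k : ℕ} → m ≤ k →
  take m (applyUpTo f k) ≡ applyUpTo f m
take-applyUpTo f {zero}  _           = refl
take-applyUpTo f {suc m} {suc k} (s≤s m≤k) =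
  cong (f 0 ∷_) (take-applyUpTo (λ x → f (suc x)) m≤k)

filter-concatMap : {A B : Set} {ℓ : Level} {P : Pred B ℓ} (P? : Decidable P)
  (f : A → List B) (xs : List A) →
  filter P? (concatMap f xs) ≡ concatMap (λ x → filter P? (f x)) xs
filter-concatMap P? f []       = refl
filter-concatMap P? f (x ∷ xs) =
  trans (filter-++ P? (f x) (concatMap f xs))
        (cong (filter P? (f x) ++_) (filter-concatMap P? f xs))

concatMap-[] : {A B : Set} {f : A → List B} → (∀ x → f x ≡ []) → (xs : List A) →
  concatMap f xs ≡ []
concatMap-[] f≡[] []       = refl
concatMap-[] f≡[] (x ∷ xs) = cong₂ _++_ (f≡[] x) (concatMap-[] f≡[] xs)

≤ᵇ-true : {m n : ℕ} → m ≤ n → (m ≤ᵇ n) ≡ true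
≤ᵇ-true {m} {n} = dec-true (m ≤? n)

≤ᵇ-false : {m n : ℕ} → ¬ m ≤ n → (m ≤ᵇ n) ≡ false
≤ᵇ-false {m} {n} = dec-false (m ≤? n)

module FullInformation (N : Network) (Input : Set) where
  open Network N
  open Model N Input
  open Run

  Snapshot : Set
  Snapshot = Fin n → LState

  Message : Set
  Message = Fin n × ℕ × LState

  received : LState → List Message
  received (st _ _ ms) = ms

  delivery : Run → Fin n → ℕ → ℕ → Snapshot → Fin n → List Message
  delivery r j t s σ k =
    if does (chan? k j) ∧ (s + delay r k j s ≤ᵇ t)
    then [ (k , s + delay r k j s , σ k) ] else []

  deliveries : Run → Fin n → ℕ → ℕ × Snapshot → List Message
  deliveries r j t (s , σ) = concatMap (delivery r j t s σ) (allFin n)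

  -- The messages j has received by time t, given the past global states;
  -- by definition of fip, received (local r j t) = inbox r j t (statesBefore r t).
  inbox : Run → Fin n → ℕ → List (ℕ × Snapshot) → List Message
  inbox r j t past = concatMap (deliveries r j t) past

  snapshot : Run → ℕ → ℕ × Snapshot
  snapshot r s = s , λ m → local r m s

  history-snapshots : (r : Run) (t : ℕ) → statesBefore r t ≡ map (snapshot r) (upTo t)
  history-snapshots r zero    = refl
  history-snapshots r (suc t) = begin
    statesBefore r t ++ [ snapshot r t ]
      ≡⟨ cong (_++ [ snapshot r t ]) (history-snapshots r t) ⟩
    map (snapshot r) (upTo t) ++ [ snapshot r t ]
      ≡⟨ sym (map-++ (snapshot r) (upTo t) [ t ]) ⟩
    map (snapshot r) (upTo t ∷ʳ t)
      ≡⟨ cong (map (snapshot r)) (upTo-∷ʳ t) ⟩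
    map (snapshot r) (upTo (suc t)) ∎
    where open ≡-Reasoning

  delivery-content : ∀ r j t s σ k {msg} → msg ∈ delivery r j t s σ k →
    msg ≡ (k , s + delay r k j s , σ k)
  delivery-content r j t s σ k msg∈
    with does (chan? k j) ∧ (s + delay r k j s ≤ᵇ t) | msg∈
  ... | true  | here eq = eq
  ... | false | ()

  received-sound : ∀ r j t {k x σ} → (k , x , σ) ∈ received (local r j t) →
    ∃[ s ] (σ ≡ local r k s)
  received-sound r j t msg∈
    with snap , snap∈ , msg∈snap ← find (∈-concatMap⁻ (deliveries r j t) msg∈)
    with s , _ , refl ← ∈-map⁻ (snapshot r) (subst (snap ∈_) (history-snapshots r t) snap∈)
    with k , _ , msg∈del ←
           find (∈-concatMap⁻ (delivery r j t s (proj₂ (snapshot r s))) {xs = allFin n} msg∈snap)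
    with refl ← delivery-content r j t s (proj₂ (snapshot r s)) k msg∈del
    = s , refl

  received-complete : ∀ r i j s t → Chan i j → s + delay r i j s ≤ t →
    (i , s + delay r i j s , local r i s) ∈ received (local r j t)
  received-complete r i j s t c arrived =
    ∈-concatMap⁺ (deliveries r j t)
      (lose snap∈ (∈-concatMap⁺ (delivery r j t s σ) (lose (∈-allFin i) in-delivery)))
    where
    s<t : s < t
    s<t = <-≤-trans (m<m+n s (delay≥1 r i j s c)) arrived

    snap∈ : snapshot r s ∈ statesBefore r t
    snap∈ = subst (snapshot r s ∈_) (sym (history-snapshots r t))
                  (∈-map⁺ (snapshot r) (∈-upTo⁺ s<t))

    σ : Snapshot
    σ = proj₂ (snapshot r s)

    in-delivery : (i , s + delay r i j s , local r i s) ∈ delivery r j t s σ i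
    in-delivery with chan? i j
    ... | no ¬c = ⊥-elim (¬c c)
    ... | yes _ rewrite ≤ᵇ-true arrived = here refl

  relay : ∀ r₁ r₂ i k s t → Chan i k → s + b i k ≤ t →
    local r₁ k t ≡ local r₂ k t → local r₁ i s ≡ local r₂ i s
  relay r₁ r₂ i k s t c s+b≤t same-k =
    same-clock (received-sound r₂ k t (subst (λ σ → msg ∈ received σ) same-k sent))
    where
    msg : Message
    msg = i , s + delay r₁ i k s , local r₁ i s

    sent : msg ∈ received (local r₁ k t)
    sent = received-complete r₁ i k s t c (≤-trans (+-monoʳ-≤ s (delay≤b r₁ i k s c)) s+b≤t)

    clock : LState → ℕ
    clock (st u _ _) = u

    -- a state records its own time, so the sending time is recovered
    same-clock : ∃[ s' ] (local r₁ i s ≡ local r₂ i s') → local r₁ i s ≡ local r₂ i s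
    same-clock (s' , eq) = trans eq (sym (cong (local r₂ i) (cong clock eq)))

  arrived-by : (t : ℕ) → Decidable (λ (msg : Message) → proj₁ (proj₂ msg) ≤ t)
  arrived-by t msg = proj₁ (proj₂ msg) ≤? t

  restrict : ℕ → LState → LState
  restrict t (st _ inputs ms) = st t (take (suc t) inputs) (filter (arrived-by t) ms)

  delivery-restrict : ∀ r j {t t'} s σ k → t ≤ t' →
    filter (arrived-by t) (delivery r j t' s σ k) ≡ delivery r j t s σ k
  delivery-restrict r j {t} {t'} s σ k t≤t' with does (chan? k j)
  ... | false = refl
  ... | true with s + delay r k j s ≤? t
  ...   | yes a rewrite ≤ᵇ-true a | ≤ᵇ-true (≤-trans a t≤t') = filter-accept (arrived-by t) a
  ...   | no ¬a rewrite ≤ᵇ-false ¬a with s + delay r k j s ≤ᵇ t'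
  ...     | true  = filter-reject (arrived-by t) ¬a
  ...     | false = refl

  -- Nothing sent at time s ≥ t has arrived by t, since delays are ≥ 1.
  delivery-silent : ∀ r j {t} s σ k → t ≤ s → delivery r j t s σ k ≡ []
  delivery-silent r j s σ k t≤s with chan? k j
  ... | no _  = refl
  ... | yes c
    rewrite ≤ᵇ-false (λ arrived → <⇒≱ (m<m+n s (delay≥1 r k j s c)) (≤-trans arrived t≤s))
    = refl

  inbox-restrict : ∀ r j {t t'} past → t ≤ t' →
    filter (arrived-by t) (inbox r j t' past) ≡ inbox r j t past
  inbox-restrict r j {t} {t'} past t≤t' =
    trans (filter-concatMap (arrived-by t) (deliveries r j t') past)
          (concatMap-cong restrict-sender past)
    where
    restrict-sender : ∀ snap →
      filter (arrived-by t) (deliveries r j t' snap) ≡ deliveries r j t snap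
    restrict-sender (s , σ) =
      trans (filter-concatMap (arrived-by t) (delivery r j t' s σ) (allFin n))
            (concatMap-cong (λ k → delivery-restrict r j s σ k t≤t') (allFin n))

  inbox-ignores-later : ∀ r j t {m} → t ≤′ m →
    inbox r j t (statesBefore r m) ≡ inbox r j t (statesBefore r t)
  inbox-ignores-later r j t ≤′-refl = refl
  inbox-ignores-later r j t (≤′-step {m} t≤′m) = begin
    inbox r j t (statesBefore r m ++ [ snapshot r m ])
      ≡⟨ concatMap-++ (deliveries r j t) (statesBefore r m) [ snapshot r m ] ⟩
    inbox r j t (statesBefore r m) ++ deliveries r j t (snapshot r m) ++ []
      ≡⟨ cong₂ _++_ (inbox-ignores-later r j t t≤′m) (cong (_++ []) last-silent) ⟩
    inbox r j t (statesBefore r t) ++ []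
      ≡⟨ ++-identityʳ _ ⟩
    inbox r j t (statesBefore r t) ∎
    where
    open ≡-Reasoning
    last-silent : deliveries r j t (snapshot r m) ≡ []
    last-silent =
      concatMap-[] (λ k → delivery-silent r j m (proj₂ (snapshot r m)) k (≤′⇒≤ t≤′m)) (allFin n)

  restrict-local : ∀ r j {t t'} → t ≤ t' → restrict t (local r j t') ≡ local r j t
  restrict-local r j {t} {t'} t≤t' = cong₂ (st t) inputs-prefix messages-arrived
    where
    inputs-prefix : take (suc t) (map (λ u → u , ext r j u) (upTo (suc t')))
                  ≡ map (λ u → u , ext r j u) (upTo (suc t))
    inputs-prefix = trans (take-map (suc t) (upTo (suc t')))
                          (cong (map _) (take-applyUpTo (λ u → u) (s≤s t≤t')))

    messages-arrived : filter (arrived-by t) (inbox r j t' (statesBefore r t'))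
                     ≡ inbox r j t (statesBefore r t)
    messages-arrived = trans (inbox-restrict r j (statesBefore r t') t≤t')
                             (inbox-ignores-later r j t (≤⇒≤′ t≤t'))

  agreement-persists : ∀ r₁ r₂ j {t t'} → t ≤ t' →
    local r₁ j t' ≡ local r₂ j t' → local r₁ j t ≡ local r₂ j t
  agreement-persists r₁ r₂ j {t} {t'} t≤t' same-j = begin
    local r₁ j t               ≡⟨ sym (restrict-local r₁ j t≤t') ⟩
    restrict t (local r₁ j t') ≡⟨ cong (restrict t) same-j ⟩
    restrict t (local r₂ j t') ≡⟨ restrict-local r₂ j t≤t' ⟩
    local r₂ j t               ∎
    where open ≡-Reasoning

  walk-agreement : ∀ r₁ r₂ {i j w} → Walk i j w → ∀ {t t'} → t + w ≤ t' →
    local r₁ j t' ≡ local r₂ j t' → local r₁ i t ≡ local r₂ i t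
  walk-agreement r₁ r₂ {i} here {t} {t'} t+0≤t' same-j =
    agreement-persists r₁ r₂ i (subst (_≤ t') (+-identityʳ t) t+0≤t') same-j
  walk-agreement r₁ r₂ {i} (step {k = k} {w = w} c walk) {t} {t'} t+b+w≤t' same-j =
    relay r₁ r₂ i k t (t + b i k) c ≤-refl
      (walk-agreement r₁ r₂ walk (subst (_≤ t') (sym (+-assoc t (b i k) w)) t+b+w≤t') same-j)

  -- Under a bound guarantee (i,t) ⇢ (j,t'), j's state at t' determines i's
  -- state at t (only a walk of weight ≤ t' - t is needed, not minimality).
  guarantee-agreement : ∀ r₁ r₂ i j t t' → (i , t) ⇢ (j , t') →
    local r₁ j t' ≡ local r₂ j t' → local r₁ i t ≡ local r₂ i t
  guarantee-agreement r₁ r₂ i j t t' (d , (walk , _) , t+d≤t') =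
    walk-agreement r₁ r₂ walk t+d≤t'

mainTheorem16 : (N : Network) (Input : Set) →
    let open Model N Input in
    (φ : Fact) (r : Run) (i j : Fin (Network.n N)) (t t' : ℕ) →
    K i φ r t → (i , t) ⇢ (j , t') →
    K i (At t' (K j (At t (K i φ)))) r t
mainTheorem16 N Input φ r i j t t' Kiφ guarantee r' r'∼r r'' r''∼r' r''' r'''∼r'' =
  Kiφ r''' (trans r'''∼r'' (trans r''∼r r'∼r))
  where
  open Model N Input using (local)
  open FullInformation N Input
  -- j's state at t' is the same in r'' and r', hence so is i's state at t
  r''∼r : local r'' i t ≡ local r' i t
  r''∼r = guarantee-agreement r'' r' i j t t' guarantee r''∼r'
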